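{- Let $m\geq2$ be an integer. Then for all integers $N\geq m^2$, $$\sum_{a=0}^{m-1}\mathbb{E}\left(\left(\Phi_{\mathrm{rand}}(N;m,a)-\frac{1}{m}\right)^2\right)\ll\frac{m^2}{N},$$ with an absolute implied constant.
   Context: Let $X_1,X_2,\dots$ be independent random variables each taking the values $1$ and $-1$ with probability $1/2$, and $S_k=X_1+\cdots+X_k$. Define the random variable $\Phi_{\mathrm{rand}}(N;m,a)=\frac{1}{N}\left|\{1\le k\leq N: S_k\equiv a\bmod m\}\right|$. $\mathbb{E}$ denotes expectation. -}

module Defs where

open import Data.Bool using (if_then_else_)
open import Data.Nat as ℕ using (ℕ; zero; suc)
open import Data.Nat.Divisibility using (_∣?_)
open import Data.Integer as ℤ using (ℤ; +_; ∣_∣)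
open import Data.Rational as ℚ using (ℚ; 0ℚ)
open import Data.List using (List; []; _∷_; map; concatMap; take; length; foldr; upTo)
open import Relation.Nullary.Decidable using (⌊_⌋)

sumℤ : List ℤ → ℤ
sumℤ = foldr ℤ._+_ (+ 0)

sumℚ : List ℚ → ℚ
sumℚ = foldr ℚ._+_ 0ℚ

-- c / n as a rational; the case n = 0 is a junk value never used in the theorem.
frac : ℕ → ℕ → ℚ
frac c zero    = 0ℚ
frac c (suc n) = (+ c) ℚ./ (suc n)

signSeqs : ℕ → List (List ℤ)
signSeqs zero    = [] ∷ []
signSeqs (suc n) = concatMap (λ xs → (+ 1 ∷ xs) ∷ (ℤ.- (+ 1) ∷ xs) ∷ []) (signSeqs n)

S : List ℤ → ℕ → ℤ
S xs k = sumℤ (take k xs)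

congMod : ℤ → ℕ → ℕ → ℕ
congMod x a m = if ⌊ m ∣? ∣ x ℤ.- (+ a) ∣ ⌋ then 1 else 0

count : (N m a : ℕ) → List ℤ → ℕ
count N m a xs = foldr ℕ._+_ 0 (map (λ j → congMod (S xs (suc j)) a m) (upTo N))

Φrand : (N m a : ℕ) → List ℤ → ℚ
Φrand N m a xs = frac (count N m a xs) N

-- Expectation of a function of (X_1,…,X_N): uniform average over {1,-1}^N.
𝔼 : (N : ℕ) → (List ℤ → ℚ) → ℚ
𝔼 N f = sumℚ (map f (signSeqs N)) ℚ.* frac 1 (length (signSeqs N))

sq : ℚ → ℚ
sq q = q ℚ.* q

variance-sum : (N m : ℕ) → ℚ
variance-sum N m = sumℚ (map (λ a → 𝔼 N (λ xs → sq (Φrand N m a xs ℚ.- frac 1 m))) (upTo m))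

-- Let t_k be the residue of S_k - a modulo m. For the walk t_k on ℤ/m the
-- function P(0) = m, P(t) = t (m - t) solves a Poisson equation: with
-- h(0) = 0 and h(t) = m - 2t,
--   P(t_k) - P(t_{k-1}) = X_k h(t_{k-1}) + m [t_k = 0] - 1.
-- Summing over k ≤ N gives m·#{k ≤ N : S_k ≡ a} - N = P(t_N) - P(t_0) - M_N,
-- where M_N = Σ X_k h(t_{k-1}) is a martingale with increments bounded by m.
-- Hence E (m·count - N)² ≤ 2 (m²)² + 2 E M_N² ≤ 2m⁴ + 2Nm² ≤ 4m²N once N ≥ m²;
-- dividing by (mN)² and summing over the m residues a gives 4m/N ≤ 4m²/N.
-- Expectations are averages over the 2^N sign sequences, so all of this is
-- finite integer arithmetic, and E M_N² ≤ N m² because the cross terms of the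
-- martingale sum to zero.

module Submission where

open import Defs
open import Data.Nat using (ℕ; _*_)
open import Data.Nat as ℕ using ()
open import Data.Integer using (+_)
open import Data.Rational as ℚ using (ℚ)
open import Data.Product using (∃-syntax)

open import Data.Integer using (ℤ; -[1+_])
import Data.Integer as ℤ hiding (+_)
open import Data.Integer.Divisibility.Signed using (_∣_; divides; ∣ᵤ⇒∣; ∣⇒∣ᵤ; ∣m∣n⇒∣m+n; ∣m∣n⇒∣m-n; ∣-refl; ∣m⇒∣-m)
import Data.Integer.Properties as ℤ
open import Data.Integer.Tactic.RingSolver using (solve-∀)
open import Algebra.Properties.CommutativeSemigroup ℤ.+-commutativeSemigroup
  using () renaming (interchange to +-interchange)
open import Data.List using (List; []; _∷_; map; concatMap; length; applyUpTo; upTo)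
open import Data.List.Membership.Propositional using (_∈_)
open import Data.List.Membership.Propositional.Properties using (∈-upTo⁻)
open import Data.List.Properties using (map-upTo; map-cong; length-upTo)
open import Data.List.Relation.Unary.Any using (here; there)
open import Data.Nat using (zero; suc; _^_)
import Data.Nat.Divisibility as ℕ
open import Data.Nat.ListAction using (sum)
import Data.Nat.Properties as ℕ
import Data.Nat.Tactic.RingSolver as ℕ
open import Data.Product using (Σ; _,_; _×_)
import Data.Rational.Properties as ℚ
open import Data.Rational.Unnormalised.Base using (mkℚᵘ; *≡*; *≤*)
import Data.Rational.Unnormalised.Base as ℚᵘ
import Data.Rational.Unnormalised.Properties as ℚᵘ
open import Function using (_∘_)
open import Relation.Binary.PropositionalEquality
  using (_≡_; refl; sym; trans; cong; cong₂; subst; subst₂; module ≡-Reasoning)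
open import Relation.Nullary using (yes; no; contradiction)

+-∸ : ∀ {m n} → n ℕ.≤ m → + (m ℕ.∸ n) ≡ + m ℤ.- + n
+-∸ {m} {n} n≤m = sym (trans (ℤ.m-n≡m⊖n m n) (ℤ.⊖-≥ n≤m))

i*i≥0 : ∀ i → + 0 ℤ.≤ i ℤ.* i
i*i≥0 (+ n)    = subst (+ 0 ℤ.≤_) (ℤ.pos-* n n) (ℤ.+≤+ ℕ.z≤n)
i*i≥0 -[1+ n ] = ℤ.+≤+ ℕ.z≤n

sq-sub-≤ : ∀ {p q K} → p ℕ.≤ K → q ℕ.≤ K → (+ p ℤ.- + q) ℤ.* (+ p ℤ.- + q) ℤ.≤ + K ℤ.* + K
sq-sub-≤ {p} {q} {K} p≤K q≤K = subst ((+ p ℤ.- + q) ℤ.* (+ p ℤ.- + q) ℤ.≤_) (sym K²-split) (ℤ.i≤i+j _ (+ ((K ℕ.∸ p ℕ.+ q) * (K ℕ.∸ q ℕ.+ p))))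
  where
  split : ∀ P Q K → K ℤ.* K ≡ (P ℤ.- Q) ℤ.* (P ℤ.- Q) ℤ.+ ((K ℤ.- P) ℤ.+ Q) ℤ.* ((K ℤ.- Q) ℤ.+ P)
  split = solve-∀
  K²-split : + K ℤ.* + K ≡ (+ p ℤ.- + q) ℤ.* (+ p ℤ.- + q) ℤ.+ + ((K ℕ.∸ p ℕ.+ q) * (K ℕ.∸ q ℕ.+ p))
  K²-split = begin
    + K ℤ.* + K
      ≡⟨ split (+ p) (+ q) (+ K) ⟩
    (+ p ℤ.- + q) ℤ.* (+ p ℤ.- + q) ℤ.+ ((+ K ℤ.- + p) ℤ.+ + q) ℤ.* ((+ K ℤ.- + q) ℤ.+ + p)
      ≡⟨ cong₂ (λ a b → (+ p ℤ.- + q) ℤ.* (+ p ℤ.- + q) ℤ.+ (a ℤ.+ + q) ℤ.* (b ℤ.+ + p)) (sym (+-∸ p≤K)) (sym (+-∸ q≤K)) ⟩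
    (+ p ℤ.- + q) ℤ.* (+ p ℤ.- + q) ℤ.+ + (K ℕ.∸ p ℕ.+ q) ℤ.* + (K ℕ.∸ q ℕ.+ p)
      ≡⟨ cong (ℤ._+_ ((+ p ℤ.- + q) ℤ.* (+ p ℤ.- + q))) (sym (ℤ.pos-* (K ℕ.∸ p ℕ.+ q) (K ℕ.∸ q ℕ.+ p))) ⟩
    (+ p ℤ.- + q) ℤ.* (+ p ℤ.- + q) ℤ.+ + ((K ℕ.∸ p ℕ.+ q) * (K ℕ.∸ q ℕ.+ p)) ∎
    where open ≡-Reasoning

sq-sub-≤-2* : ∀ b c → (b ℤ.- c) ℤ.* (b ℤ.- c) ℤ.≤ + 2 ℤ.* (b ℤ.* b) ℤ.+ + 2 ℤ.* (c ℤ.* c)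
sq-sub-≤-2* b c = subst ((b ℤ.- c) ℤ.* (b ℤ.- c) ℤ.≤_) (parallelogram b c)
  (ℤ.i≤i+j _ ((b ℤ.+ c) ℤ.* (b ℤ.+ c)) {{ℤ.nonNegative (i*i≥0 (b ℤ.+ c))}})
  where
  parallelogram : ∀ b c → (b ℤ.- c) ℤ.* (b ℤ.- c) ℤ.+ (b ℤ.+ c) ℤ.* (b ℤ.+ c) ≡ + 2 ℤ.* (b ℤ.* b) ℤ.+ + 2 ℤ.* (c ℤ.* c)
  parallelogram = solve-∀

applyUpTo-cong : ∀ {A : Set} {f g : ℕ → A} n → (∀ j → f j ≡ g j) → applyUpTo f n ≡ applyUpTo g n
applyUpTo-cong zero    f≡g = refl
applyUpTo-cong (suc n) f≡g = cong₂ _∷_ (f≡g 0) (applyUpTo-cong n (f≡g ∘ suc))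

∑ : {A : Set} → List A → (A → ℤ) → ℤ
∑ xs f = sumℤ (map f xs)

syntax ∑ xs (λ x → e) = ∑[ x ∈ xs ] e

module _ {A : Set} where

  ∑-distrib-+ : ∀ (xs : List A) f g → ∑[ x ∈ xs ] (f x ℤ.+ g x) ≡ ∑ xs f ℤ.+ ∑ xs g
  ∑-distrib-+ []       f g = refl
  ∑-distrib-+ (x ∷ xs) f g = begin
    (f x ℤ.+ g x) ℤ.+ ∑[ y ∈ xs ] (f y ℤ.+ g y) ≡⟨ cong (ℤ._+_ (f x ℤ.+ g x)) (∑-distrib-+ xs f g) ⟩
    (f x ℤ.+ g x) ℤ.+ (∑ xs f ℤ.+ ∑ xs g)       ≡⟨ +-interchange (f x) (g x) (∑ xs f) (∑ xs g) ⟩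
    (f x ℤ.+ ∑ xs f) ℤ.+ (g x ℤ.+ ∑ xs g)       ∎
    where open ≡-Reasoning

  ∑-*ˡ : ∀ (xs : List A) c f → ∑[ x ∈ xs ] (c ℤ.* f x) ≡ c ℤ.* ∑ xs f
  ∑-*ˡ []       c f = sym (ℤ.*-zeroʳ c)
  ∑-*ˡ (x ∷ xs) c f = trans (cong (ℤ._+_ (c ℤ.* f x)) (∑-*ˡ xs c f)) (sym (ℤ.*-distribˡ-+ c (f x) (∑ xs f)))

  ∑-const : ∀ (xs : List A) c → ∑[ x ∈ xs ] c ≡ + length xs ℤ.* c
  ∑-const []       c = sym (ℤ.*-zeroˡ c)
  ∑-const (x ∷ xs) c = begin
    c ℤ.+ ∑[ x ∈ xs ] c              ≡⟨ cong (ℤ._+_ c) (∑-const xs c) ⟩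
    c ℤ.+ + length xs ℤ.* c          ≡⟨ cong (ℤ._+ + length xs ℤ.* c) (sym (ℤ.*-identityˡ c)) ⟩
    + 1 ℤ.* c ℤ.+ + length xs ℤ.* c  ≡⟨ ℤ.*-distribʳ-+ c (+ 1) (+ length xs) ⟨
    + suc (length xs) ℤ.* c          ∎
    where open ≡-Reasoning

  ∑-cong : ∀ (xs : List A) {f g} → (∀ x → f x ≡ g x) → ∑ xs f ≡ ∑ xs g
  ∑-cong []       _   = refl
  ∑-cong (x ∷ xs) f≡g = cong₂ ℤ._+_ (f≡g x) (∑-cong xs f≡g)

  ∑-+const : ∀ (xs : List A) c f → ∑[ x ∈ xs ] (c ℤ.+ f x) ≡ + length xs ℤ.* c ℤ.+ ∑ xs f
  ∑-+const xs c f = trans (∑-distrib-+ xs (λ _ → c) f) (cong (ℤ._+ ∑ xs f) (∑-const xs c))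

  ∑-≤-length* : ∀ (xs : List A) f c → (∀ x → x ∈ xs → f x ℤ.≤ c) → ∑ xs f ℤ.≤ + length xs ℤ.* c
  ∑-≤-length* xs f c f≤c = subst (∑ xs f ℤ.≤_) (∑-const xs c) (∑-mono-≤ xs f≤c)
    where
    ∑-mono-≤ : ∀ ys → (∀ y → y ∈ ys → f y ℤ.≤ c) → ∑ ys f ℤ.≤ ∑[ y ∈ ys ] c
    ∑-mono-≤ []       _ = ℤ.≤-refl
    ∑-mono-≤ (y ∷ ys) h = ℤ.+-mono-≤ (h y (here refl)) (∑-mono-≤ ys (λ z z∈ys → h z (there z∈ys)))

∑-shifted-square : ∀ {A : Set} (xs : List A) c f →
  ∑[ x ∈ xs ] ((c ℤ.+ f x) ℤ.* (c ℤ.+ f x)) ≡ + length xs ℤ.* (c ℤ.* c) ℤ.+ (+ 2 ℤ.* c ℤ.* ∑ xs f ℤ.+ ∑[ x ∈ xs ] (f x ℤ.* f x))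
∑-shifted-square xs c f = begin
  ∑[ x ∈ xs ] ((c ℤ.+ f x) ℤ.* (c ℤ.+ f x))
    ≡⟨ ∑-cong xs (λ x → expand c (f x)) ⟩
  ∑[ x ∈ xs ] (c ℤ.* c ℤ.+ (+ 2 ℤ.* c ℤ.* f x ℤ.+ f x ℤ.* f x))
    ≡⟨ ∑-+const xs (c ℤ.* c) _ ⟩
  + length xs ℤ.* (c ℤ.* c) ℤ.+ ∑[ x ∈ xs ] (+ 2 ℤ.* c ℤ.* f x ℤ.+ f x ℤ.* f x)
    ≡⟨ cong (ℤ._+_ (+ length xs ℤ.* (c ℤ.* c))) (trans (∑-distrib-+ xs _ _) (cong (ℤ._+ _) (∑-*ˡ xs (+ 2 ℤ.* c) f))) ⟩
  + length xs ℤ.* (c ℤ.* c) ℤ.+ (+ 2 ℤ.* c ℤ.* ∑ xs f ℤ.+ ∑[ x ∈ xs ] (f x ℤ.* f x)) ∎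
  where
  open ≡-Reasoning
  expand : ∀ c y → (c ℤ.+ y) ℤ.* (c ℤ.+ y) ≡ c ℤ.* c ℤ.+ (+ 2 ℤ.* c ℤ.* y ℤ.+ y ℤ.* y)
  expand = solve-∀

data SignSeq : ℕ → List ℤ → Set where
  []    : SignSeq 0 []
  +1∷_ : ∀ {n xs} → SignSeq n xs → SignSeq (suc n) (+ 1 ∷ xs)
  -1∷_ : ∀ {n xs} → SignSeq n xs → SignSeq (suc n) (-[1+ 0 ] ∷ xs)

extend : List ℤ → List (List ℤ)
extend xs = (+ 1 ∷ xs) ∷ (ℤ.- + 1 ∷ xs) ∷ []

∑-signSeqs-suc : ∀ n f → ∑ (signSeqs (suc n)) f ≡ ∑[ xs ∈ signSeqs n ] f (+ 1 ∷ xs) ℤ.+ ∑[ xs ∈ signSeqs n ] f (-[1+ 0 ] ∷ xs)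
∑-signSeqs-suc n f = trans (∑-concatMap (signSeqs n)) (∑-distrib-+ (signSeqs n) _ _)
  where
  ∑-concatMap : ∀ L → ∑ (concatMap extend L) f ≡ ∑[ xs ∈ L ] (f (+ 1 ∷ xs) ℤ.+ f (-[1+ 0 ] ∷ xs))
  ∑-concatMap []       = refl
  ∑-concatMap (xs ∷ L) = trans (sym (ℤ.+-assoc (f (+ 1 ∷ xs)) _ _)) (cong (ℤ._+_ (f (+ 1 ∷ xs) ℤ.+ f (-[1+ 0 ] ∷ xs))) (∑-concatMap L))

length-signSeqs : ∀ n → length (signSeqs n) ≡ 2 ^ n
length-signSeqs zero    = refl
length-signSeqs (suc n) = trans (length-concatMap (signSeqs n)) (cong (2 *_) (length-signSeqs n))
  where
  length-concatMap : ∀ L → length (concatMap extend L) ≡ 2 * length L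
  length-concatMap []       = refl
  length-concatMap (xs ∷ L) = trans (cong (suc ∘ suc) (length-concatMap L)) (sym (ℕ.*-distribˡ-+ 2 1 (length L)))

∑-signSeqs-mono-≤ : ∀ n f g → (∀ xs → SignSeq n xs → f xs ℤ.≤ g xs) → ∑ (signSeqs n) f ℤ.≤ ∑ (signSeqs n) g
∑-signSeqs-mono-≤ zero    f g f≤g = ℤ.+-monoˡ-≤ (+ 0) (f≤g [] [])
∑-signSeqs-mono-≤ (suc n) f g f≤g = subst₂ ℤ._≤_ (sym (∑-signSeqs-suc n f)) (sym (∑-signSeqs-suc n g))
  (ℤ.+-mono-≤ (∑-signSeqs-mono-≤ n _ _ (λ xs s → f≤g _ (+1∷ s))) (∑-signSeqs-mono-≤ n _ _ (λ xs s → f≤g _ (-1∷ s))))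

module Walk {S : Set} (next : ℤ → S → S) where

  final : S → List ℤ → S
  final s []       = s
  final s (x ∷ xs) = final (next x s) xs

  total : (S → ℤ) → S → List ℤ → ℤ
  total w s []       = + 0
  total w s (x ∷ xs) = w (next x s) ℤ.+ total w (next x s) xs

  martingale : (S → ℤ) → S → List ℤ → ℤ
  martingale h s []       = + 0
  martingale h s (x ∷ xs) = x ℤ.* h s ℤ.+ martingale h (next x s) xs

  final-preserves : ∀ (Inv : S → Set) → (∀ x s → Inv s → Inv (next x s)) → ∀ {s} xs → Inv s → Inv (final s xs)
  final-preserves Inv preserved []       inv = inv
  final-preserves Inv preserved (x ∷ xs) inv = final-preserves Inv preserved xs (preserved x _ inv)

  PoissonStep : (P h w : S → ℤ) → ℤ → Set
  PoissonStep P h w x = ∀ s → P (next x s) ℤ.- P s ≡ x ℤ.* h s ℤ.+ (w (next x s) ℤ.- + 1)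

  total-via-potential : ∀ P h w → PoissonStep P h w (+ 1) → PoissonStep P h w -[1+ 0 ] →
    ∀ {n xs} → SignSeq n xs → ∀ s →
    total w s xs ℤ.- + n ≡ (P (final s xs) ℤ.- P s) ℤ.- martingale h s xs
  total-via-potential P h w step₊ step₋ = go
    where
    go : ∀ {n xs} → SignSeq n xs → ∀ s → total w s xs ℤ.- + n ≡ (P (final s xs) ℤ.- P s) ℤ.- martingale h s xs
    cons : ∀ x → PoissonStep P h w x → ∀ {n xs} → SignSeq n xs → ∀ s →
      total w s (x ∷ xs) ℤ.- + suc n ≡ (P (final s (x ∷ xs)) ℤ.- P s) ℤ.- martingale h s (x ∷ xs)
    go []         s = vanish (P s)
      where
      vanish : ∀ Q → + 0 ℤ.- + 0 ≡ (Q ℤ.- Q) ℤ.- + 0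
      vanish = solve-∀
    go (+1∷ seq) s = cons (+ 1) step₊ seq s
    go (-1∷ seq) s = cons -[1+ 0 ] step₋ seq s
    cons x step {n} {xs} seq s = begin
      (w s′ ℤ.+ total w s′ xs) ℤ.- + suc n
        ≡⟨ regroup (w s′) (total w s′ xs) (+ n) ⟩
      (total w s′ xs ℤ.- + n) ℤ.+ (w s′ ℤ.- + 1)
        ≡⟨ cong₂ ℤ._+_ (go seq s′) (isolate (step s)) ⟩
      ((P (final s′ xs) ℤ.- P s′) ℤ.- martingale h s′ xs) ℤ.+ ((P s′ ℤ.- P s) ℤ.- x ℤ.* h s)
        ≡⟨ telescope (P (final s′ xs)) (P s′) (P s) (martingale h s′ xs) (x ℤ.* h s) ⟩
      (P (final s′ xs) ℤ.- P s) ℤ.- (x ℤ.* h s ℤ.+ martingale h s′ xs)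
        ∎
      where
      open ≡-Reasoning
      s′ = next x s
      regroup : ∀ W T N → (W ℤ.+ T) ℤ.- (+ 1 ℤ.+ N) ≡ (T ℤ.- N) ℤ.+ (W ℤ.- + 1)
      regroup = solve-∀
      telescope : ∀ E Q R M D → ((E ℤ.- Q) ℤ.- M) ℤ.+ ((Q ℤ.- R) ℤ.- D) ≡ (E ℤ.- R) ℤ.- (D ℤ.+ M)
      telescope = solve-∀
      isolate : ∀ {Δ D U} → Δ ≡ D ℤ.+ U → U ≡ Δ ℤ.- D
      isolate {D = D} {U} refl = cancel D U
        where
        cancel : ∀ D U → U ≡ (D ℤ.+ U) ℤ.- D
        cancel = solve-∀

  ∑-martingale≡0 : ∀ h n s → ∑ (signSeqs n) (martingale h s) ≡ + 0
  ∑-martingale≡0 h zero    s = refl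
  ∑-martingale≡0 h (suc n) s = begin
    ∑ (signSeqs (suc n)) (martingale h s)
      ≡⟨ ∑-signSeqs-suc n (martingale h s) ⟩
    ∑[ xs ∈ L ] (+ 1 ℤ.* h s ℤ.+ M₊ xs) ℤ.+ ∑[ xs ∈ L ] (-[1+ 0 ] ℤ.* h s ℤ.+ M₋ xs)
      ≡⟨ cong₂ ℤ._+_ (∑-+const L (+ 1 ℤ.* h s) M₊) (∑-+const L (-[1+ 0 ] ℤ.* h s) M₋) ⟩
    (+ length L ℤ.* (+ 1 ℤ.* h s) ℤ.+ ∑ L M₊) ℤ.+ (+ length L ℤ.* (-[1+ 0 ] ℤ.* h s) ℤ.+ ∑ L M₋)
      ≡⟨ cong₂ (λ a b → (+ length L ℤ.* (+ 1 ℤ.* h s) ℤ.+ a) ℤ.+ (+ length L ℤ.* (-[1+ 0 ] ℤ.* h s) ℤ.+ b))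
           (∑-martingale≡0 h n _) (∑-martingale≡0 h n _) ⟩
    (+ length L ℤ.* (+ 1 ℤ.* h s) ℤ.+ + 0) ℤ.+ (+ length L ℤ.* (ℤ.- + 1 ℤ.* h s) ℤ.+ + 0)
      ≡⟨ increments-cancel (+ length L) (h s) ⟩
    + 0 ∎
    where
    open ≡-Reasoning
    L = signSeqs n
    M₊ = martingale h (next (+ 1) s)
    M₋ = martingale h (next -[1+ 0 ] s)
    increments-cancel : ∀ ℓ H → (ℓ ℤ.* (+ 1 ℤ.* H) ℤ.+ + 0) ℤ.+ (ℓ ℤ.* (ℤ.- + 1 ℤ.* H) ℤ.+ + 0) ≡ + 0
    increments-cancel = solve-∀

  ∑-martingale²-≤ : ∀ h (Inv : S → Set) → (∀ x s → Inv s → Inv (next x s)) →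
    ∀ B → (∀ s → Inv s → h s ℤ.* h s ℤ.≤ B) →
    ∀ n s → Inv s → ∑[ xs ∈ signSeqs n ] (martingale h s xs ℤ.* martingale h s xs) ℤ.≤ + n ℤ.* (+ (2 ^ n) ℤ.* B)
  ∑-martingale²-≤ h Inv preserved B h²≤B = go
    where
    go : ∀ n s → Inv s → ∑[ xs ∈ signSeqs n ] (martingale h s xs ℤ.* martingale h s xs) ℤ.≤ + n ℤ.* (+ (2 ^ n) ℤ.* B)
    go zero    s _   = ℤ.≤-refl
    go (suc n) s inv = subst₂ ℤ._≤_ (sym (∑-signSeqs-suc n _)) double
      (ℤ.+-mono-≤ (branch (+ 1) refl) (branch -[1+ 0 ] refl))
      where
      L = signSeqs n
      X = + (2 ^ n) ℤ.* B
      branch : ∀ x → x ℤ.* x ≡ + 1 →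
        ∑[ xs ∈ L ] ((x ℤ.* h s ℤ.+ martingale h (next x s) xs) ℤ.* (x ℤ.* h s ℤ.+ martingale h (next x s) xs))
          ℤ.≤ X ℤ.+ + n ℤ.* X
      branch x x²≡1 = begin
        ∑[ xs ∈ L ] ((c ℤ.+ M xs) ℤ.* (c ℤ.+ M xs))
          ≡⟨ ∑-shifted-square L c M ⟩
        + length L ℤ.* (c ℤ.* c) ℤ.+ (+ 2 ℤ.* c ℤ.* ∑ L M ℤ.+ ∑[ xs ∈ L ] (M xs ℤ.* M xs))
          ≡⟨ cong₂ (λ ℓ Σ → + ℓ ℤ.* (c ℤ.* c) ℤ.+ (+ 2 ℤ.* c ℤ.* Σ ℤ.+ ∑[ xs ∈ L ] (M xs ℤ.* M xs)))
               (length-signSeqs n) (∑-martingale≡0 h n (next x s)) ⟩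
        + (2 ^ n) ℤ.* (c ℤ.* c) ℤ.+ (+ 2 ℤ.* c ℤ.* + 0 ℤ.+ ∑[ xs ∈ L ] (M xs ℤ.* M xs))
          ≡⟨ cong (ℤ._+_ (+ (2 ^ n) ℤ.* (c ℤ.* c))) (drop-cross-term (+ 2 ℤ.* c) _) ⟩
        + (2 ^ n) ℤ.* (c ℤ.* c) ℤ.+ ∑[ xs ∈ L ] (M xs ℤ.* M xs)
          ≤⟨ ℤ.+-mono-≤ (ℤ.*-monoˡ-≤-nonNeg (+ (2 ^ n)) (subst (ℤ._≤ B) (sym c²≡h²) (h²≤B s inv)))
                        (go n (next x s) (preserved x s inv)) ⟩
        X ℤ.+ + n ℤ.* X ∎
        where
        open ℤ.≤-Reasoning
        c = x ℤ.* h s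
        M = martingale h (next x s)
        drop-cross-term : ∀ a Q → a ℤ.* + 0 ℤ.+ Q ≡ Q
        drop-cross-term = solve-∀
        regroup : ∀ x H → (x ℤ.* H) ℤ.* (x ℤ.* H) ≡ (x ℤ.* x) ℤ.* (H ℤ.* H)
        regroup = solve-∀
        c²≡h² : c ℤ.* c ≡ h s ℤ.* h s
        c²≡h² = trans (regroup x (h s)) (trans (cong (ℤ._* (h s ℤ.* h s)) x²≡1) (ℤ.*-identityˡ (h s ℤ.* h s)))
      double : (X ℤ.+ + n ℤ.* X) ℤ.+ (X ℤ.+ + n ℤ.* X) ≡ + suc n ℤ.* (+ (2 ^ suc n) ℤ.* B)
      double = trans (regroup (+ (2 ^ n)) (+ n) B)
        (cong₂ (λ a b → a ℤ.* (b ℤ.* B)) (sym (ℤ.pos-+ 1 n)) (sym (ℤ.pos-* 2 (2 ^ n))))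
        where
        regroup : ∀ T ℓ B → (T ℤ.* B ℤ.+ ℓ ℤ.* (T ℤ.* B)) ℤ.+ (T ℤ.* B ℤ.+ ℓ ℤ.* (T ℤ.* B))
                          ≡ (+ 1 ℤ.+ ℓ) ℤ.* ((+ 2 ℤ.* T) ℤ.* B)
        regroup = solve-∀

module Cycle (k : ℕ) where

  m : ℕ
  m = suc (suc k)

  sucMod : ℕ → ℕ
  sucMod t with suc t ℕ.≟ m
  ... | yes _ = 0
  ... | no  _ = suc t

  predMod : ℕ → ℕ
  predMod zero    = suc k
  predMod (suc t) = t

  -- Only the steps ±1 are ever taken, so every x ≥ 0 is read as +1.
  step : ℤ → ℕ → ℕ
  step (+ _)    = sucMod
  step -[1+ _ ] = predMod

  open Walk step public

  step-bounded : ∀ x {t} → t ℕ.< m → step x t ℕ.< m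
  step-bounded (+ _) {t} t<m with suc t ℕ.≟ m
  ... | yes _   = ℕ.s≤s ℕ.z≤n
  ... | no  t+1≢m = ℕ.≤∧≢⇒< t<m t+1≢m
  step-bounded -[1+ _ ] {zero}  _   = ℕ.≤-refl
  step-bounded -[1+ _ ] {suc t} t<m = ℕ.<-trans (ℕ.n<1+n t) t<m

  weight : ℕ → ℤ
  weight zero    = + m
  weight (suc _) = + 0

  potential : ℕ → ℤ
  potential zero    = + m
  potential (suc t) = + suc t ℤ.* (+ m ℤ.- + suc t)

  drift : ℕ → ℤ
  drift zero    = + 0
  drift (suc t) = (+ m ℤ.- + suc t) ℤ.- + suc t

  poisson₊ : PoissonStep potential drift weight (+ 1)
  poisson₊ t with suc t ℕ.≟ m
  poisson₊ zero    | no _     = from-0 (+ k)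
    where
    from-0 : ∀ K → (+ 1 ℤ.* ((+ 2 ℤ.+ K) ℤ.- + 1)) ℤ.- (+ 2 ℤ.+ K) ≡ + 1 ℤ.* + 0 ℤ.+ (+ 0 ℤ.- + 1)
    from-0 = solve-∀
  poisson₊ (suc t) | yes refl = wrap (+ k)
    where
    wrap : ∀ K → (+ 2 ℤ.+ K) ℤ.- (+ 1 ℤ.+ K) ℤ.* ((+ 2 ℤ.+ K) ℤ.- (+ 1 ℤ.+ K))
         ≡ + 1 ℤ.* (((+ 2 ℤ.+ K) ℤ.- (+ 1 ℤ.+ K)) ℤ.- (+ 1 ℤ.+ K)) ℤ.+ ((+ 2 ℤ.+ K) ℤ.- + 1)
    wrap = solve-∀
  poisson₊ (suc t) | no _     = inner (+ k) (+ t)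
    where
    inner : ∀ K T → (+ 2 ℤ.+ T) ℤ.* ((+ 2 ℤ.+ K) ℤ.- (+ 2 ℤ.+ T)) ℤ.- (+ 1 ℤ.+ T) ℤ.* ((+ 2 ℤ.+ K) ℤ.- (+ 1 ℤ.+ T))
          ≡ + 1 ℤ.* (((+ 2 ℤ.+ K) ℤ.- (+ 1 ℤ.+ T)) ℤ.- (+ 1 ℤ.+ T)) ℤ.+ (+ 0 ℤ.- + 1)
    inner = solve-∀

  poisson₋ : PoissonStep potential drift weight -[1+ 0 ]
  poisson₋ zero          = wrap (+ k)
    where
    wrap : ∀ K → (+ 1 ℤ.+ K) ℤ.* ((+ 2 ℤ.+ K) ℤ.- (+ 1 ℤ.+ K)) ℤ.- (+ 2 ℤ.+ K) ≡ ℤ.- + 1 ℤ.* + 0 ℤ.+ (+ 0 ℤ.- + 1)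
    wrap = solve-∀
  poisson₋ (suc zero)    = to-0 (+ k)
    where
    to-0 : ∀ K → (+ 2 ℤ.+ K) ℤ.- + 1 ℤ.* ((+ 2 ℤ.+ K) ℤ.- + 1)
         ≡ ℤ.- + 1 ℤ.* (((+ 2 ℤ.+ K) ℤ.- + 1) ℤ.- + 1) ℤ.+ ((+ 2 ℤ.+ K) ℤ.- + 1)
    to-0 = solve-∀
  poisson₋ (suc (suc t)) = inner (+ k) (+ t)
    where
    inner : ∀ K T → (+ 1 ℤ.+ T) ℤ.* ((+ 2 ℤ.+ K) ℤ.- (+ 1 ℤ.+ T)) ℤ.- (+ 2 ℤ.+ T) ℤ.* ((+ 2 ℤ.+ K) ℤ.- (+ 2 ℤ.+ T))
          ≡ ℤ.- + 1 ℤ.* (((+ 2 ℤ.+ K) ℤ.- (+ 2 ℤ.+ T)) ℤ.- (+ 2 ℤ.+ T)) ℤ.+ (+ 0 ℤ.- + 1)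
    inner = solve-∀

  drift²≤m² : ∀ t → t ℕ.< m → drift t ℤ.* drift t ℤ.≤ + (m * m)
  drift²≤m² zero    _   = ℤ.+≤+ ℕ.z≤n
  drift²≤m² (suc t) t<m = subst₂ (λ d M → d ℤ.* d ℤ.≤ M) (cong (ℤ._- + suc t) (+-∸ (ℕ.<⇒≤ t<m))) (sym (ℤ.pos-* m m))
    (sq-sub-≤ (ℕ.m∸n≤m m (suc t)) (ℕ.<⇒≤ t<m))

  potential-natural : ∀ t → t ℕ.< m → Σ ℕ λ p → potential t ≡ + p × p ℕ.≤ m * m
  potential-natural zero    _   = m , refl , ℕ.m≤m*n m m
  potential-natural (suc t) t<m = suc t * (m ℕ.∸ suc t) ,
    trans (cong (ℤ._*_ (+ suc t)) (sym (+-∸ (ℕ.<⇒≤ t<m)))) (sym (ℤ.pos-* (suc t) (m ℕ.∸ suc t))) ,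
    ℕ.*-mono-≤ (ℕ.<⇒≤ t<m) (ℕ.m∸n≤m m (suc t))

  potential-gap² : ∀ {t t′} → t ℕ.< m → t′ ℕ.< m →
    (potential t ℤ.- potential t′) ℤ.* (potential t ℤ.- potential t′) ℤ.≤ + (m * m) ℤ.* + (m * m)
  potential-gap² {t} {t′} t<m t′<m
    with p , P≡p , p≤ ← potential-natural t t<m | q , P′≡q , q≤ ← potential-natural t′ t′<m
    rewrite P≡p | P′≡q = sq-sub-≤ p≤ q≤

  record Residue (a : ℕ) (y : ℤ) (t : ℕ) : Set where
    constructor residue
    field
      bounded   : t ℕ.< m
      divisible : + m ∣ (y ℤ.- + a) ℤ.- + t

  Residue-weight : ∀ {a y t} → Residue a y t → + m ℤ.* + congMod y a m ≡ weight t
  Residue-weight {a} {y} {t} (residue t<m m∣) with m ℕ.∣? ℤ.∣ y ℤ.- + a ∣ | t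
  ... | yes _ | zero  = ℤ.*-identityʳ (+ m)
  ... | no ¬m∣ | zero = contradiction (∣⇒∣ᵤ (subst (+ m ∣_) (ℤ.+-identityʳ (y ℤ.- + a)) m∣)) ¬m∣
  ... | no _  | suc _ = ℤ.*-zeroʳ (+ m)
  ... | yes m∣′ | suc t′ = contradiction (ℕ.∣⇒≤ (∣⇒∣ᵤ m∣t)) (ℕ.<⇒≱ t<m)
    where
    cancel : ∀ u v → u ℤ.- (u ℤ.- v) ≡ v
    cancel = solve-∀
    m∣t : + m ∣ + suc t′
    m∣t = subst (+ m ∣_) (cancel (y ℤ.- + a) (+ suc t′)) (∣m∣n⇒∣m-n {m = y ℤ.- + a} (∣ᵤ⇒∣ m∣′) m∣)

  Residue-suc : ∀ {a y t} → Residue a y t → Residue a (y ℤ.+ + 1) (sucMod t)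
  Residue-suc {a} {y} {t} (residue t<m m∣) with suc t ℕ.≟ m
  Residue-suc {a} {y} {suc t} (residue t<m m∣) | yes refl = residue (ℕ.s≤s ℕ.z≤n)
    (subst (+ m ∣_) (sym (wrap y (+ a) (+ k))) (∣m∣n⇒∣m+n m∣ ∣-refl))
    where
    wrap : ∀ Y A K → ((Y ℤ.+ + 1) ℤ.- A) ℤ.- + 0 ≡ ((Y ℤ.- A) ℤ.- (+ 1 ℤ.+ K)) ℤ.+ (+ 2 ℤ.+ K)
    wrap = solve-∀
  Residue-suc {a} {y} {t} (residue t<m m∣) | no t+1≢m = residue (ℕ.≤∧≢⇒< t<m t+1≢m)
    (subst (+ m ∣_) (sym (shift y (+ a) (+ t))) m∣)
    where
    shift : ∀ Y A T → ((Y ℤ.+ + 1) ℤ.- A) ℤ.- (+ 1 ℤ.+ T) ≡ (Y ℤ.- A) ℤ.- T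
    shift = solve-∀

  Residue-pred : ∀ {a y t} → Residue a y t → Residue a (y ℤ.+ -[1+ 0 ]) (predMod t)
  Residue-pred {a} {y} {zero}  (residue _ m∣)   = residue ℕ.≤-refl
    (subst (+ m ∣_) (sym (wrap y (+ a) (+ k))) (∣m∣n⇒∣m-n m∣ ∣-refl))
    where
    wrap : ∀ Y A K → ((Y ℤ.+ ℤ.- + 1) ℤ.- A) ℤ.- (+ 1 ℤ.+ K) ≡ ((Y ℤ.- A) ℤ.- + 0) ℤ.- (+ 2 ℤ.+ K)
    wrap = solve-∀
  Residue-pred {a} {y} {suc t} (residue t<m m∣) = residue (ℕ.<-trans (ℕ.n<1+n t) t<m)
    (subst (+ m ∣_) (sym (shift y (+ a) (+ t))) m∣)
    where
    shift : ∀ Y A T → ((Y ℤ.+ ℤ.- + 1) ℤ.- A) ℤ.- T ≡ (Y ℤ.- A) ℤ.- (+ 1 ℤ.+ T)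
    shift = solve-∀

  origin : ℕ → ℕ
  origin zero    = 0
  origin (suc a) = m ℕ.∸ suc a

  Residue-origin : ∀ {a} → a ℕ.< m → Residue a (+ 0) (origin a)
  Residue-origin {zero}  _   = residue (ℕ.s≤s ℕ.z≤n) (divides (+ 0) refl)
  Residue-origin {suc a} a<m = residue (ℕ.∸-monoʳ-< {m} {suc a} {0} (ℕ.s≤s ℕ.z≤n) (ℕ.<⇒≤ a<m))
    (subst (+ m ∣_) (sym eq) (∣m⇒∣-m ∣-refl))
    where
    cancel : ∀ A M → (+ 0 ℤ.- A) ℤ.- (M ℤ.- A) ≡ ℤ.- M
    cancel = solve-∀
    eq : (+ 0 ℤ.- + suc a) ℤ.- + (m ℕ.∸ suc a) ≡ ℤ.- + m
    eq = trans (cong (ℤ._-_ (+ 0 ℤ.- + suc a)) (+-∸ (ℕ.<⇒≤ a<m))) (cancel (+ suc a) (+ m))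

  hits : ℕ → ℤ → List ℤ → ℕ → ℕ
  hits a y xs n = sum (applyUpTo (λ j → congMod (y ℤ.+ S xs (suc j)) a m) n)

  hits-total : ∀ {a n xs} → SignSeq n xs → ∀ {y t} → Residue a y t → + m ℤ.* + hits a y xs n ≡ total weight t xs
  hits-total {a} = go
    where
    go : ∀ {n xs} → SignSeq n xs → ∀ {y t} → Residue a y t → + m ℤ.* + hits a y xs n ≡ total weight t xs
    cons : ∀ {n xs} x → (∀ {y t} → Residue a y t → Residue a (y ℤ.+ x) (step x t)) → SignSeq n xs →
      ∀ {y t} → Residue a y t → + m ℤ.* + hits a y (x ∷ xs) (suc n) ≡ total weight t (x ∷ xs)
    go []        _ = ℤ.*-zeroʳ (+ m)
    go (+1∷ seq) = cons (+ 1) Residue-suc seq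
    go (-1∷ seq) = cons -[1+ 0 ] Residue-pred seq
    cons {n} {xs} x residue-step seq {y} {t} R = begin
      + m ℤ.* + (c₀ ℕ.+ sum rest)                  ≡⟨ cong (ℤ._*_ (+ m)) (ℤ.pos-+ c₀ (sum rest)) ⟩
      + m ℤ.* (+ c₀ ℤ.+ + sum rest)                ≡⟨ ℤ.*-distribˡ-+ (+ m) (+ c₀) (+ sum rest) ⟩
      + m ℤ.* + c₀ ℤ.+ + m ℤ.* + sum rest
        ≡⟨ cong₂ (λ c r → + m ℤ.* + congMod c a m ℤ.+ + m ℤ.* + sum r) (cong (ℤ._+_ y) (ℤ.+-identityʳ x))
             (applyUpTo-cong n (λ j → cong (λ z → congMod z a m) (sym (ℤ.+-assoc y x (S xs (suc j)))))) ⟩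
      + m ℤ.* + congMod (y ℤ.+ x) a m ℤ.+ + m ℤ.* + hits a (y ℤ.+ x) xs n
        ≡⟨ cong₂ ℤ._+_ (Residue-weight (residue-step R)) (go seq (residue-step R)) ⟩
      weight (step x t) ℤ.+ total weight (step x t) xs ∎
      where
      open ≡-Reasoning
      c₀ = congMod (y ℤ.+ (x ℤ.+ + 0)) a m
      rest = applyUpTo (λ j → congMod (y ℤ.+ (x ℤ.+ S xs (suc j))) a m) n

  count≡total : ∀ {a N xs} → a ℕ.< m → SignSeq N xs → + m ℤ.* + count N m a xs ≡ total weight (origin a) xs
  count≡total {a} {N} {xs} a<m seq = begin
    + m ℤ.* + sum (map (λ j → congMod (S xs (suc j)) a m) (upTo N))
      ≡⟨ cong (λ hs → + m ℤ.* + sum hs) (trans (map-upTo _ N)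
           (applyUpTo-cong N (λ j → cong (λ z → congMod z a m) (sym (ℤ.+-identityˡ (S xs (suc j))))))) ⟩
    + m ℤ.* + hits a (+ 0) xs N
      ≡⟨ hits-total seq (Residue-origin a<m) ⟩
    total weight (origin a) xs ∎
    where open ≡-Reasoning

  deviation : ℕ → ℕ → List ℤ → ℤ
  deviation N a xs = + m ℤ.* + count N m a xs ℤ.- + N

  deviation≡ : ∀ {a N xs} → a ℕ.< m → SignSeq N xs →
    deviation N a xs ≡ (potential (final (origin a) xs) ℤ.- potential (origin a)) ℤ.- martingale drift (origin a) xs
  deviation≡ {a} {N} a<m seq = trans (cong (ℤ._- + N) (count≡total a<m seq))
    (total-via-potential potential drift weight poisson₊ poisson₋ seq (origin a))

  ∑-deviation²-≤ : ∀ {a N} → a ℕ.< m → m * m ℕ.≤ N →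
    ∑[ xs ∈ signSeqs N ] (deviation N a xs ℤ.* deviation N a xs) ℤ.≤ + (2 ^ N * (4 * (m * m * N)))
  ∑-deviation²-≤ {a} {N} a<m m²≤N = begin
    ∑[ xs ∈ L ] (deviation N a xs ℤ.* deviation N a xs)
      ≤⟨ ∑-signSeqs-mono-≤ N _ _ pointwise ⟩
    ∑[ xs ∈ L ] (C ℤ.+ + 2 ℤ.* (M xs ℤ.* M xs))
      ≡⟨ trans (∑-+const L C _) (cong (ℤ._+_ (+ length L ℤ.* C)) (∑-*ˡ L (+ 2) (λ xs → M xs ℤ.* M xs))) ⟩
    + length L ℤ.* C ℤ.+ + 2 ℤ.* ∑[ xs ∈ L ] (M xs ℤ.* M xs)
      ≡⟨ cong (λ ℓ → + ℓ ℤ.* C ℤ.+ + 2 ℤ.* ∑[ xs ∈ L ] (M xs ℤ.* M xs)) (length-signSeqs N) ⟩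
    + (2 ^ N) ℤ.* C ℤ.+ + 2 ℤ.* ∑[ xs ∈ L ] (M xs ℤ.* M xs)
      ≤⟨ ℤ.+-mono-≤ (ℤ.*-monoˡ-≤-nonNeg (+ (2 ^ N)) (ℤ.*-monoˡ-≤-nonNeg (+ 2) m⁴≤m²N))
           (ℤ.*-monoˡ-≤-nonNeg (+ 2) (∑-martingale²-≤ drift (ℕ._< m) (λ x _ → step-bounded x) (+ (m * m)) drift²≤m² N t₀ t₀<m)) ⟩
    + (2 ^ N) ℤ.* (+ 2 ℤ.* (+ (m * m) ℤ.* + N)) ℤ.+ + 2 ℤ.* (+ N ℤ.* (+ (2 ^ N) ℤ.* + (m * m)))
      ≡⟨ collect (+ (2 ^ N)) (+ (m * m)) (+ N) ⟩
    + (2 ^ N) ℤ.* (+ 4 ℤ.* (+ (m * m) ℤ.* + N))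
      ≡⟨ cong (ℤ._*_ (+ (2 ^ N))) (trans (cong (ℤ._*_ (+ 4)) (sym (ℤ.pos-* (m * m) N))) (sym (ℤ.pos-* 4 (m * m * N)))) ⟩
    + (2 ^ N) ℤ.* + (4 * (m * m * N))
      ≡⟨ ℤ.pos-* (2 ^ N) (4 * (m * m * N)) ⟨
    + (2 ^ N * (4 * (m * m * N))) ∎
    where
    open ℤ.≤-Reasoning
    L = signSeqs N
    t₀ = origin a
    t₀<m = Residue.bounded (Residue-origin a<m)
    M = martingale drift t₀
    C = + 2 ℤ.* (+ (m * m) ℤ.* + (m * m))
    pointwise : ∀ xs → SignSeq N xs → deviation N a xs ℤ.* deviation N a xs ℤ.≤ C ℤ.+ + 2 ℤ.* (M xs ℤ.* M xs)
    pointwise xs seq = subst (λ d → d ℤ.* d ℤ.≤ C ℤ.+ + 2 ℤ.* (M xs ℤ.* M xs)) (sym (deviation≡ a<m seq))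
      (ℤ.≤-trans (sq-sub-≤-2* (potential (final t₀ xs) ℤ.- potential t₀) (M xs))
        (ℤ.+-monoˡ-≤ _ (ℤ.*-monoˡ-≤-nonNeg (+ 2)
          (potential-gap² (final-preserves (ℕ._< m) (λ x _ → step-bounded x) xs t₀<m) t₀<m))))
    m⁴≤m²N : + (m * m) ℤ.* + (m * m) ℤ.≤ + (m * m) ℤ.* + N
    m⁴≤m²N = ℤ.*-monoˡ-≤-nonNeg (+ (m * m)) (ℤ.+≤+ m²≤N)
    collect : ∀ P Q N → P ℤ.* (+ 2 ℤ.* (Q ℤ.* N)) ℤ.+ + 2 ℤ.* (N ℤ.* (P ℤ.* Q)) ≡ P ℤ.* (+ 4 ℤ.* (Q ℤ.* N))
    collect = solve-∀

-- i / suc d is definitionally fromℚᵘ (mkℚᵘ i d), so arithmetic of such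
-- fractions is ℚᵘ arithmetic transported along the homomorphism fromℚᵘ.
fromℚᵘ-homo-+ : ∀ p q → ℚ.fromℚᵘ (p ℚᵘ.+ q) ≡ ℚ.fromℚᵘ p ℚ.+ ℚ.fromℚᵘ q
fromℚᵘ-homo-+ p q = ℚ.toℚᵘ-injective (ℚᵘ.≃-trans (ℚ.toℚᵘ-fromℚᵘ (p ℚᵘ.+ q)) (ℚᵘ.≃-sym
  (ℚᵘ.≃-trans (ℚ.toℚᵘ-homo-+ (ℚ.fromℚᵘ p) (ℚ.fromℚᵘ q)) (ℚᵘ.+-cong (ℚ.toℚᵘ-fromℚᵘ p) (ℚ.toℚᵘ-fromℚᵘ q)))))

fromℚᵘ-homo-* : ∀ p q → ℚ.fromℚᵘ (p ℚᵘ.* q) ≡ ℚ.fromℚᵘ p ℚ.* ℚ.fromℚᵘ q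
fromℚᵘ-homo-* p q = ℚ.toℚᵘ-injective (ℚᵘ.≃-trans (ℚ.toℚᵘ-fromℚᵘ (p ℚᵘ.* q)) (ℚᵘ.≃-sym
  (ℚᵘ.≃-trans (ℚ.toℚᵘ-homo-* (ℚ.fromℚᵘ p) (ℚ.fromℚᵘ q)) (ℚᵘ.*-cong (ℚ.toℚᵘ-fromℚᵘ p) (ℚ.toℚᵘ-fromℚᵘ q)))))

fromℚᵘ-homo‿- : ∀ p → ℚ.fromℚᵘ (ℚᵘ.- p) ≡ ℚ.- ℚ.fromℚᵘ p
fromℚᵘ-homo‿- p = ℚ.toℚᵘ-injective (ℚᵘ.≃-trans (ℚ.toℚᵘ-fromℚᵘ (ℚᵘ.- p)) (ℚᵘ.≃-sym
  (ℚᵘ.≃-trans (ℚ.toℚᵘ-homo‿- (ℚ.fromℚᵘ p)) (ℚᵘ.-‿cong (ℚ.toℚᵘ-fromℚᵘ p)))))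

+-/ : ∀ i j n → i ℚ./ suc n ℚ.+ j ℚ./ suc n ≡ (i ℤ.+ j) ℚ./ suc n
+-/ i j n = trans (sym (fromℚᵘ-homo-+ (mkℚᵘ i n) (mkℚᵘ j n))) (ℚ.fromℚᵘ-cong {mkℚᵘ i n ℚᵘ.+ mkℚᵘ j n} {mkℚᵘ (i ℤ.+ j) n} (*≡* (common i j (+ suc n))))
  where
  common : ∀ i j d → (i ℤ.* d ℤ.+ j ℤ.* d) ℤ.* d ≡ (i ℤ.+ j) ℤ.* (d ℤ.* d)
  common = solve-∀

*-/ : ∀ i j d e → (i ℚ./ suc d) ℚ.* (j ℚ./ suc e) ≡ (i ℤ.* j) ℚ./ (suc d * suc e)
*-/ i j d e = sym (fromℚᵘ-homo-* (mkℚᵘ i d) (mkℚᵘ j e))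

/-mono-≤ : ∀ {i j d e} → i ℤ.* + suc e ℤ.≤ j ℤ.* + suc d → i ℚ./ suc d ℚ.≤ j ℚ./ suc e
/-mono-≤ {i} {j} {d} {e} le = ℚ.toℚᵘ-cancel-≤
  (ℚᵘ.≤-respˡ-≃ (ℚᵘ.≃-sym (ℚ.toℚᵘ-fromℚᵘ (mkℚᵘ i d))) (ℚᵘ.≤-respʳ-≃ (ℚᵘ.≃-sym (ℚ.toℚᵘ-fromℚᵘ (mkℚᵘ j e))) (*≤* le)))

sq-sub-/ : ∀ c d e → sq (+ c ℚ./ suc d ℚ.- + 1 ℚ./ suc e)
  ≡ ((+ suc e ℤ.* + c ℤ.- + suc d) ℤ.* (+ suc e ℤ.* + c ℤ.- + suc d)) ℚ./ (suc d * suc e * (suc d * suc e))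
sq-sub-/ c d e = begin
  sq (ℚ.fromℚᵘ u ℚ.+ ℚ.- ℚ.fromℚᵘ v)      ≡⟨ cong (λ w → sq (ℚ.fromℚᵘ u ℚ.+ w)) (sym (fromℚᵘ-homo‿- v)) ⟩
  sq (ℚ.fromℚᵘ u ℚ.+ ℚ.fromℚᵘ (ℚᵘ.- v))   ≡⟨ cong sq (sym (fromℚᵘ-homo-+ u (ℚᵘ.- v))) ⟩
  sq (ℚ.fromℚᵘ (u ℚᵘ.- v))                ≡⟨ sym (fromℚᵘ-homo-* (u ℚᵘ.- v) (u ℚᵘ.- v)) ⟩
  ℚ.fromℚᵘ ((u ℚᵘ.- v) ℚᵘ.* (u ℚᵘ.- v))   ≡⟨ cong (λ z → (z ℤ.* z) ℚ./ (suc d * suc e * (suc d * suc e))) (numerator (+ c) (+ suc d) (+ suc e)) ⟩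
  ((+ suc e ℤ.* + c ℤ.- + suc d) ℤ.* (+ suc e ℤ.* + c ℤ.- + suc d)) ℚ./ (suc d * suc e * (suc d * suc e)) ∎
  where
  open ≡-Reasoning
  u = mkℚᵘ (+ c) d
  v = mkℚᵘ (+ 1) e
  numerator : ∀ C D E → C ℤ.* E ℤ.+ ℤ.- + 1 ℤ.* D ≡ E ℤ.* C ℤ.- D
  numerator = solve-∀

/-≤-/ : ∀ {i t c d e} → i ℤ.≤ + t → t * suc e ℕ.≤ c * suc d → i ℚ./ suc d ℚ.≤ + c ℚ./ suc e
/-≤-/ {i} {t} {c} {d} {e} i≤t te≤cd = /-mono-≤ {i} {+ c} {d} {e} (begin
  i ℤ.* + suc e    ≤⟨ ℤ.*-monoʳ-≤-nonNeg (+ suc e) i≤t ⟩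
  + t ℤ.* + suc e  ≡⟨ ℤ.pos-* t (suc e) ⟨
  + (t * suc e)    ≤⟨ ℤ.+≤+ te≤cd ⟩
  + (c * suc d)    ≡⟨ ℤ.pos-* c (suc d) ⟩
  + c ℤ.* + suc d  ∎)
  where open ℤ.≤-Reasoning

sumℚ-/ : ∀ {A : Set} (xs : List A) f d → sumℚ (map (λ x → f x ℚ./ suc d) xs) ≡ ∑ xs f ℚ./ suc d
sumℚ-/ []       f d = sym (ℚ.0/n≡0 (suc d))
sumℚ-/ (x ∷ xs) f d = trans (cong (ℚ._+_ (f x ℚ./ suc d)) (sumℚ-/ xs f d)) (+-/ (f x) (∑ xs f) d)

sumℚ-*ʳ : ∀ {A : Set} (xs : List A) g w → sumℚ (map (λ x → g x ℚ.* w) xs) ≡ sumℚ (map g xs) ℚ.* w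
sumℚ-*ʳ []       g w = sym (ℚ.*-zeroˡ w)
sumℚ-*ʳ (x ∷ xs) g w = trans (cong (ℚ._+_ (g x ℚ.* w)) (sumℚ-*ʳ xs g w)) (sym (ℚ.*-distribʳ-+ w (g x) (sumℚ (map g xs))))

module Variance (k N′ : ℕ) where
  open Cycle k

  N : ℕ
  N = suc N′

  deviation²-sum : ℤ
  deviation²-sum = ∑[ a ∈ upTo m ] ∑[ xs ∈ signSeqs N ] (deviation N a xs ℤ.* deviation N a xs)

  variance-sum≡ : variance-sum N m ≡ (deviation²-sum ℚ./ (N * m * (N * m))) ℚ.* frac 1 (length (signSeqs N))
  variance-sum≡ = begin
    sumℚ (map (λ a → sumℚ (map (λ xs → sq (Φrand N m a xs ℚ.- frac 1 m)) L) ℚ.* W) (upTo m))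
      ≡⟨ cong sumℚ (map-cong (λ a → cong (ℚ._* W) (trans
           (cong sumℚ (map-cong (λ xs → sq-sub-/ (count N m a xs) N′ (suc k)) L)) (sumℚ-/ L _ _))) (upTo m)) ⟩
    sumℚ (map (λ a → (T a ℚ./ (N * m * (N * m))) ℚ.* W) (upTo m))
      ≡⟨ sumℚ-*ʳ (upTo m) (λ a → T a ℚ./ (N * m * (N * m))) W ⟩
    sumℚ (map (λ a → T a ℚ./ (N * m * (N * m))) (upTo m)) ℚ.* W
      ≡⟨ cong (ℚ._* W) (sumℚ-/ (upTo m) T _) ⟩
    (deviation²-sum ℚ./ (N * m * (N * m))) ℚ.* W ∎
    where
    open ≡-Reasoning
    L = signSeqs N
    W = frac 1 (length L)
    T : ℕ → ℤ
    T a = ∑[ xs ∈ L ] (deviation N a xs ℤ.* deviation N a xs)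

  deviation²-sum-≤ : m * m ℕ.≤ N → deviation²-sum ℤ.≤ + (m * (2 ^ N * (4 * (m * m * N))))
  deviation²-sum-≤ m²≤N = begin
    deviation²-sum
      ≤⟨ ∑-≤-length* (upTo m) _ (+ b) (λ a a∈upTo → ∑-deviation²-≤ (∈-upTo⁻ a∈upTo) m²≤N) ⟩
    + length (upTo m) ℤ.* + b ≡⟨ cong (λ ℓ → + ℓ ℤ.* + b) (length-upTo m) ⟩
    + m ℤ.* + b               ≡⟨ ℤ.pos-* m b ⟨
    + (m * b)                 ∎
    where
    open ℤ.≤-Reasoning
    b = 2 ^ N * (4 * (m * m * N))

  variance-sum-≤ : m * m ℕ.≤ N → variance-sum N m ℚ.≤ frac 4 1 ℚ.* frac (m * m) N
  variance-sum-≤ m²≤N = subst₂ ℚ._≤_ (sym variance-sum≡) (sym rhs) (bound (length (signSeqs N)) (length-signSeqs N))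
    where
    rhs : frac 4 1 ℚ.* frac (m * m) N ≡ + (4 * (m * m)) ℚ./ (1 * N)
    rhs = trans (*-/ (+ 4) (+ (m * m)) 0 N′) (cong (ℚ._/ (1 * N)) (sym (ℤ.pos-* 4 (m * m))))
    -- Only the factor m ≤ m * m is given away: the variance sum is in fact at most 4m/N.
    cross : ∀ P → m * (P * (4 * (m * m * N))) * (1 * N) ℕ.≤ 4 * (m * m) * (N * m * (N * m) * P)
    cross P = subst₂ ℕ._≤_ (sym (lhs m P N)) (sym (rhs′ m P N)) (ℕ.*-monoˡ-≤ (P * 4 * (m * m) * (N * N)) (ℕ.m≤m*n m m))
      where
      lhs : ∀ m P N → m * (P * (4 * (m * m * N))) * (1 * N) ≡ m * (P * 4 * (m * m) * (N * N))
      lhs = ℕ.solve-∀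
      rhs′ : ∀ m P N → 4 * (m * m) * (N * m * (N * m) * P) ≡ m * m * (P * 4 * (m * m) * (N * N))
      rhs′ = ℕ.solve-∀
    bound : ∀ L → L ≡ 2 ^ N → (deviation²-sum ℚ./ (N * m * (N * m))) ℚ.* frac 1 L ℚ.≤ + (4 * (m * m)) ℚ./ (1 * N)
    bound zero    0≡2^N = contradiction (subst (0 ℕ.<_) (sym 0≡2^N) (ℕ.m^n>0 2 N)) λ ()
    bound (suc ℓ) ℓ+1≡2^N = subst (ℚ._≤ _) (sym (*-/ deviation²-sum (+ 1) _ ℓ))
      (/-≤-/ (subst₂ ℤ._≤_ (sym (ℤ.*-identityʳ deviation²-sum)) (cong (λ P → + (m * (P * (4 * (m * m * N))))) (sym ℓ+1≡2^N))
               (deviation²-sum-≤ m²≤N))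
             (cross (suc ℓ)))

proposition1 : ∃[ C ] ((m : ℕ) → 2 ℕ.≤ m → (N : ℕ) → m * m ℕ.≤ N →
                 variance-sum N m ℚ.≤ frac C 1 ℚ.* frac (m * m) N)
proposition1 = 4 , bound
  where
  bound : (m : ℕ) → 2 ℕ.≤ m → (N : ℕ) → m * m ℕ.≤ N → variance-sum N m ℚ.≤ frac 4 1 ℚ.* frac (m * m) N
  bound (suc (suc k)) (ℕ.s≤s (ℕ.s≤s ℕ.z≤n)) zero     ()
  bound (suc (suc k)) (ℕ.s≤s (ℕ.s≤s ℕ.z≤n)) (suc N′) m²≤N = Variance.variance-sum-≤ k N′ m²≤N
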